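{- Let $G$ be a double tree, $(T_1,T_2)$ a spanning tree factorization of $G$ and $xyz$ a triangle in $G$ such that $xy,xz \in E(T_1)$ and $yz \in E(T_2)$. Then for any tree-mapping function $\sigma:E(T_1)\rightarrow E(T_2)$, we have $\sigma(xy)\neq yz$ or $\sigma(xz)\neq yz$.
   Context: Graphs are finite and may have parallel edges. A double tree is a graph $G$ having two edge-disjoint spanning trees $T_1,T_2$ with $E(T_1)\cup E(T_2)=E(G)$; such a pair $(T_1,T_2)$ is a spanning tree factorization of $G$. A tree-mapping function from $T_1$ to $T_2$ is a function $\sigma:E(T_1)\to E(T_2)$ such that for every $e\in E(T_1)$, $(T_1-e+\sigma(e),\,T_2-\sigma(e)+e)$ is a spanning tree factorization of $G$. -}

module Defs where

open import Data.Nat using (ℕ; suc; _≥_)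
open import Data.Fin using (Fin; _≟_)
open import Data.Bool using (Bool; true; false; if_then_else_)
open import Data.Product using (_×_; _,_; Σ; ∃; ∃-syntax)
open import Data.Sum using (_⊎_)
open import Data.List using (List; []; _∷_; length)
open import Data.List.Relation.Unary.Unique.Propositional using (Unique)
open import Relation.Binary.PropositionalEquality using (_≡_)
open import Relation.Nullary using (¬_; does)

-- A finite multigraph (parallel edges and loops allowed) with vertices
-- Fin n and edges Fin m; each edge has an (unordered) pair of endpoints,
-- stored as an ordered pair whose orientation is irrelevant.
record Graph : Set where
  field
    n    : ℕ
    m    : ℕ
    ends : Fin m → Fin n × Fin n

open Graph public

EdgeSet : Graph → Set
EdgeSet G = Fin (m G) → Bool

_∈E_ : {k : ℕ} → Fin k → (Fin k → Bool) → Set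
e ∈E S = S e ≡ true

Joins : (G : Graph) → Fin (m G) → Fin (n G) → Fin (n G) → Set
Joins G e u v = (ends G e ≡ (u , v)) ⊎ (ends G e ≡ (v , u))

data Walk (G : Graph) (S : EdgeSet G) : Fin (n G) → Fin (n G) → Set where
  nil  : ∀ {u} → Walk G S u u
  cons : ∀ {u w v} (e : Fin (m G)) → e ∈E S → Joins G e u w →
         Walk G S w v → Walk G S u v

walkEdges : ∀ {G S u v} → Walk G S u v → List (Fin (m G))
walkEdges nil = []
walkEdges (cons e _ _ p) = e ∷ walkEdges p

-- the vertices at which the steps start (for a closed walk: every vertex once)
walkStarts : ∀ {G S u v} → Walk G S u v → List (Fin (n G))
walkStarts nil = []
walkStarts {u = u} (cons e _ _ p) = u ∷ walkStarts p

Cycle : (G : Graph) → EdgeSet G → Set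
Cycle G S = Σ (Fin (n G)) λ u → Σ (Walk G S u u) λ w →
  (length (walkEdges w) ≥ 1) × Unique (walkEdges w) × Unique (walkStarts w)

Connected : (G : Graph) → EdgeSet G → Set
Connected G S = (u v : Fin (n G)) → Walk G S u v

SpanningTree : (G : Graph) → EdgeSet G → Set
SpanningTree G S = Connected G S × ¬ Cycle G S

Factorization : (G : Graph) → EdgeSet G → EdgeSet G → Set
Factorization G T₁ T₂ =
  SpanningTree G T₁ × SpanningTree G T₂ ×
  (∀ e → ¬ (e ∈E T₁ × e ∈E T₂)) ×
  (∀ e → e ∈E T₁ ⊎ e ∈E T₂)

DoubleTree : Graph → Set
DoubleTree G = ∃[ T₁ ] ∃[ T₂ ] Factorization G T₁ T₂

_-_+_ : {k : ℕ} → (Fin k → Bool) → Fin k → Fin k → (Fin k → Bool)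
(T - e + f) g = if does (g ≟ f) then true else (if does (g ≟ e) then false else T g)

-- σ : E(T1) → E(T2) is a tree-mapping function (σ is given as a function
-- on all edges; only its values on E(T1) matter)
TreeMapping : (G : Graph) → EdgeSet G → EdgeSet G → (Fin (m G) → Fin (m G)) → Set
TreeMapping G T₁ T₂ σ = ∀ e → e ∈E T₁ →
  σ e ∈E T₂ × Factorization G (T₁ - e + σ e) (T₂ - σ e + e)

-- Suppose σ(xy) = σ(xz) = yz, and let R = T₂ − yz.  Both T₂ − yz + xy and
-- T₂ − yz + xz must then be trees.  A walk in T₂ from x to y either stays in R
-- or reaches an endpoint y or z of yz before first using it; so x is joined in
-- R to y or to z, and the edge xy, resp. xz, closes a cycle with that walk.
module Submission where

open import Defs
open import Data.Empty using (⊥-elim)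
open import Data.Bool using (Bool; false; if_then_else_)
open import Data.Fin using (Fin; _≟_)
open import Data.List using (List; _∷_; [])
open import Data.List.Membership.Propositional using (_∈_)
open import Data.List.Relation.Unary.All.Properties using (¬Any⇒All¬; All¬⇒¬Any)
open import Data.List.Relation.Unary.All using ([]; _∷_)
open import Data.List.Relation.Unary.AllPairs using ([]; _∷_)
open import Data.List.Relation.Unary.Any using (here; there)
open import Data.List.Relation.Unary.Unique.Propositional using (Unique)
open import Data.Nat using (s≤s; z≤n)
open import Data.Product using (_,_; Σ; proj₁; proj₂)
open import Data.Product.Properties using (,-injectiveˡ; ,-injectiveʳ)
open import Data.Sum using (_⊎_; inj₁; inj₂; [_,_]; map)
open import Function using (_∘_)
open import Relation.Binary.PropositionalEquality using (_≡_; _≢_; refl; sym; trans; cong; subst)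
open import Relation.Nullary using (¬_; yes; no; does)

_∖_ : ∀ {k} → (Fin k → Bool) → Fin k → (Fin k → Bool)
(T ∖ e) g = if does (g ≟ e) then false else T g

_⊆ₑ_ : ∀ {k} → (Fin k → Bool) → (Fin k → Bool) → Set
S ⊆ₑ S′ = ∀ {g} → g ∈E S → g ∈E S′

∖-⊆ : ∀ {k} (T : Fin k → Bool) e → (T ∖ e) ⊆ₑ T
∖-⊆ T e {g} g∈ with g ≟ e
... | no _ = g∈

∈⇒≡⊎∈∖ : ∀ {k} {T : Fin k → Bool} e {g} → g ∈E T → g ≡ e ⊎ g ∈E (T ∖ e)
∈⇒≡⊎∈∖ e {g} g∈ with g ≟ e
... | yes g≡e = inj₁ g≡e
... | no _    = inj₂ g∈

∖-⊆-exchange : ∀ {k} (T : Fin k → Bool) e f → (T ∖ e) ⊆ₑ (T - e + f)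
∖-⊆-exchange T e f {g} g∈ with g ≟ f
... | yes _ = refl
... | no _  = g∈

exchange-∋ : ∀ {k} (T : Fin k → Bool) e f → f ∈E (T - e + f)
exchange-∋ T e f with f ≟ f
... | yes _   = refl
... | no f≢f = ⊥-elim (f≢f refl)

module _ {G : Graph} where

  open import Data.List.Membership.DecPropositional {A = Fin (n G)} _≟_ using (_∈?_)

  Joins-swap : ∀ {e u v} → Joins G e u v → Joins G e v u
  Joins-swap (inj₁ eq) = inj₂ eq
  Joins-swap (inj₂ eq) = inj₁ eq

  Joins-endpoint : ∀ {e u w a b} → Joins G e u w → Joins G e a b → a ≡ u ⊎ a ≡ w
  Joins-endpoint (inj₁ p) (inj₁ q) = inj₁ (,-injectiveˡ (trans (sym q) p))
  Joins-endpoint (inj₁ p) (inj₂ q) = inj₂ (,-injectiveʳ (trans (sym q) p))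
  Joins-endpoint (inj₂ p) (inj₁ q) = inj₂ (,-injectiveˡ (trans (sym q) p))
  Joins-endpoint (inj₂ p) (inj₂ q) = inj₁ (,-injectiveʳ (trans (sym q) p))

  -- The end vertex comes first, so that closing a path by an edge from its end
  -- to its start gives a closed walk whose walkStarts are exactly these vertices.
  vertices : ∀ {S u v} → Walk G S u v → List (Fin (n G))
  vertices {v = v} p = v ∷ walkStarts p

  Path : EdgeSet G → Fin (n G) → Fin (n G) → Set
  Path S u v = Σ (Walk G S u v) λ p → Unique (vertices p)

  start∈vertices : ∀ {S u v} (p : Walk G S u v) → u ∈ vertices p
  start∈vertices nil            = here refl
  start∈vertices (cons _ _ _ _) = there (here refl)

  vertices-cons : ∀ {S u w v a} e (s : e ∈E S) (j : Joins G e u w) (p : Walk G S w v) →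
    a ∈ vertices p → a ∈ vertices (cons e s j p)
  vertices-cons _ _ _ _ (here a≡v) = here a≡v
  vertices-cons _ _ _ _ (there a∈) = there (there a∈)

  Joins⇒∈vertices : ∀ {S u v f a b} (p : Walk G S u v) →
    f ∈ walkEdges p → Joins G f a b → a ∈ vertices p
  Joins⇒∈vertices (cons e s j p) (here refl) jf with Joins-endpoint j jf
  ... | inj₁ refl = there (here refl)
  ... | inj₂ refl = vertices-cons e s j p (start∈vertices p)
  Joins⇒∈vertices (cons e s j p) (there f∈) jf = vertices-cons e s j p (Joins⇒∈vertices p f∈ jf)

  walkEdges-⊆ : ∀ {S u v f} (p : Walk G S u v) → f ∈ walkEdges p → f ∈E S
  walkEdges-⊆ (cons _ s _ _) (here refl) = s
  walkEdges-⊆ (cons _ _ _ p) (there f∈) = walkEdges-⊆ p f∈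

  path-edges-unique : ∀ {S u v} (p : Walk G S u v) → Unique (vertices p) → Unique (walkEdges p)
  path-edges-unique nil _ = []
  path-edges-unique (cons e _ j p) ((v≢u ∷ v∉) ∷ (u∉ ∷ uq)) =
    ¬Any⇒All¬ (walkEdges p) e∉ ∷ path-edges-unique p (v∉ ∷ uq)
    where
      e∉ : ¬ e ∈ walkEdges p
      e∉ e∈ with Joins⇒∈vertices p e∈ j
      ... | here u≡v = v≢u (sym u≡v)
      ... | there u∈ = All¬⇒¬Any u∉ u∈

  suffix-path : ∀ {S u w v} (q : Walk G S w v) → Unique (vertices q) → u ∈ vertices q → Path S u v
  suffix-path _ _ (here refl) = nil , [] ∷ []
  suffix-path (cons e s j q) uq (there (here refl)) = cons e s j q , uq
  suffix-path (cons _ _ _ q) ((_ ∷ v∉) ∷ (_ ∷ uq)) (there (there u∈)) = suffix-path q (v∉ ∷ uq) (there u∈)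

  walk⇒path : ∀ {S u v} → Walk G S u v → Path S u v
  walk⇒path nil = nil , [] ∷ []
  walk⇒path {u = u} (cons e s j p) with walk⇒path p
  ... | q , v∉ ∷ uq with u ∈? vertices q
  ...   | yes u∈ = suffix-path q (v∉ ∷ uq) u∈
  ...   | no u∉  = cons e s j q , ((λ v≡u → u∉ (here (sym v≡u))) ∷ v∉) ∷ (¬Any⇒All¬ _ (u∉ ∘ there) ∷ uq)

  weaken : ∀ {S S′ u v} → S ⊆ₑ S′ → Walk G S u v → Walk G S′ u v
  weaken _ nil = nil
  weaken S⊆S′ (cons e s j p) = cons e (S⊆S′ s) j (weaken S⊆S′ p)

  weaken-walkEdges : ∀ {S S′ u v} (S⊆S′ : S ⊆ₑ S′) (p : Walk G S u v) →
    walkEdges (weaken S⊆S′ p) ≡ walkEdges p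
  weaken-walkEdges _ nil = refl
  weaken-walkEdges S⊆S′ (cons e _ _ p) = cong (e ∷_) (weaken-walkEdges S⊆S′ p)

  weaken-walkStarts : ∀ {S S′ u v} (S⊆S′ : S ⊆ₑ S′) (p : Walk G S u v) →
    walkStarts (weaken S⊆S′ p) ≡ walkStarts p
  weaken-walkStarts _ nil = refl
  weaken-walkStarts {u = u} S⊆S′ (cons _ _ _ p) = cong (u ∷_) (weaken-walkStarts S⊆S′ p)

  closing-edge⇒cycle : ∀ {S S′ u v e} → S ⊆ₑ S′ → e ∈E S′ → ¬ e ∈E S →
    Joins G e v u → Path S u v → Cycle G S′
  closing-edge⇒cycle {v = v} {e} S⊆S′ e∈S′ e∉S j (p , p-path) =
    v , cons e e∈S′ j (weaken S⊆S′ p) , s≤s z≤n ,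
    subst (λ es → Unique (e ∷ es)) (sym (weaken-walkEdges S⊆S′ p))
      (¬Any⇒All¬ _ (λ e∈p → e∉S (walkEdges-⊆ p e∈p)) ∷ path-edges-unique p p-path) ,
    subst (λ vs → Unique (v ∷ vs)) (sym (weaken-walkStarts S⊆S′ p)) p-path

  avoids-or-reaches-endpoint : ∀ {S f y z u v} → Joins G f y z → Walk G S u v →
    Walk G (S ∖ f) u v ⊎ Walk G (S ∖ f) u y ⊎ Walk G (S ∖ f) u z
  avoids-or-reaches-endpoint jf nil = inj₁ nil
  avoids-or-reaches-endpoint {S} {f} jf (cons g s j p) with ∈⇒≡⊎∈∖ {T = S} f {g} s
  ... | inj₂ g∈ = map (cons g g∈ j) (map (cons g g∈ j) (cons g g∈ j)) (avoids-or-reaches-endpoint jf p)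
  ... | inj₁ refl with Joins-endpoint jf j
  ...   | inj₁ refl = inj₂ (inj₁ nil)
  ...   | inj₂ refl = inj₂ (inj₂ nil)

  exchange-creates-cycle : ∀ {S f e₁ e₂ x y z} → Connected G S → Joins G f y z →
    Joins G e₁ x y → Joins G e₂ x z → ¬ e₁ ∈E S → ¬ e₂ ∈E S →
    Cycle G (S - f + e₁) ⊎ Cycle G (S - f + e₂)
  exchange-creates-cycle {S} {f} {x = x} {y} connected jf j₁ j₂ e₁∉S e₂∉S =
    [ inj₁ ∘ close j₁ e₁∉S , map (close j₁ e₁∉S) (close j₂ e₂∉S) ]
      (avoids-or-reaches-endpoint jf (connected x y))
    where
      close : ∀ {e a} → Joins G e x a → ¬ e ∈E S → Walk G (S ∖ f) x a → Cycle G (S - f + e)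
      close {e} j e∉S w =
        closing-edge⇒cycle (∖-⊆-exchange S f e) (exchange-∋ S f e) (e∉S ∘ ∖-⊆ S f) (Joins-swap j) (walk⇒path w)

treeMapping-acyclic : ∀ {G T₁ T₂ σ e} → TreeMapping G T₁ T₂ σ → e ∈E T₁ → ¬ Cycle G (T₂ - σ e + e)
treeMapping-acyclic tm e∈T₁ = proj₂ (proj₁ (proj₂ (proj₂ (tm _ e∈T₁))))

proposition5 : (G : Graph) → DoubleTree G →
    (T₁ T₂ : EdgeSet G) → Factorization G T₁ T₂ →
    (x y z : Fin (n G)) → x ≢ y → x ≢ z → y ≢ z →
    (exy exz eyz : Fin (m G)) →
    Joins G exy x y → Joins G exz x z → Joins G eyz y z →
    exy ∈E T₁ → exz ∈E T₁ → eyz ∈E T₂ →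
    (σ : Fin (m G) → Fin (m G)) → TreeMapping G T₁ T₂ σ →
    (σ exy ≢ eyz) ⊎ (σ exz ≢ eyz)
proposition5 G _ T₁ T₂ (_ , (T₂-connected , _) , disjoint , _) x y z _ _ _ exy exz eyz
  jxy jxz jyz exy∈T₁ exz∈T₁ _ σ tm with σ exy ≟ eyz | σ exz ≟ eyz
... | no σxy≢yz | _         = inj₁ σxy≢yz
... | yes _     | no σxz≢yz = inj₂ σxz≢yz
... | yes σxy≡yz | yes σxz≡yz =
  ⊥-elim ([ acyclic exy∈T₁ σxy≡yz , acyclic exz∈T₁ σxz≡yz ]
    (exchange-creates-cycle T₂-connected jyz jxy jxz (∉T₂ exy∈T₁) (∉T₂ exz∈T₁)))
  where
    acyclic : ∀ {e} → e ∈E T₁ → σ e ≡ eyz → ¬ Cycle G (T₂ - eyz + e)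
    acyclic e∈T₁ σe≡yz = subst (λ f → ¬ Cycle G (T₂ - f + _)) σe≡yz (treeMapping-acyclic tm e∈T₁)

    ∉T₂ : ∀ {e} → e ∈E T₁ → ¬ e ∈E T₂
    ∉T₂ e∈T₁ e∈T₂ = disjoint _ (e∈T₁ , e∈T₂)
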